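{- Let $\mathcal{P}=\{p_1>p_2>\cdots>p_k\}$ be a finite nonempty set of positive integers. Then the pair $(\mathcal{P},\mathcal{P})$ is bigraphic, and there exists a bipartite graph realizing $(\mathcal{P},\mathcal{P})$ in which each stable set has exactly $p_1$ vertices. Furthermore, such a graph can be chosen to be a mirror bipartite graph.
   Context: A bipartite graph is written $G=(V_1\cup V_2,E)$ with stable sets (parts) $V_1,V_2$; graphs are finite and simple. For finite sets $\mathcal{P},\mathcal{Q}$ of integers, the pair $(\mathcal{P},\mathcal{Q})$ is bigraphic if there is a bipartite graph $G=(V_1\cup V_2,E)$ such that the set of degrees of vertices in $V_1$ is exactly $\mathcal{P}$ (each element of $\mathcal{P}$ occurs as the degree of at least one vertex of $V_1$, and every vertex of $V_1$ has degree in $\mathcal{P}$) and the set of degrees of vertices in $V_2$ is exactly $\mathcal{Q}$; such $G$ is said to realize $(\mathcal{P},\mathcal{Q})$. A mirror bipartite graph is a bipartite graph $G=(V_1\cup V_2,E)$ for which there is a bijection $\varphi:V_1\to V_2$ such that for all $u,v\in V_1$, $u\varphi(v)\in E$ if and only if $\varphi(u)v\in E$. -}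

module Defs where

open import Data.Nat using (ℕ)
open import Data.Bool using (Bool)
open import Data.Fin using (Fin)
open import Data.Vec using (countᵇ; allFin)
open import Data.List using (List)
open import Data.List.Membership.Propositional using (_∈_)
open import Data.Product using (Σ; ∃; _×_)
open import Relation.Binary.PropositionalEquality using (_≡_)
open import Function.Bundles using (_⤖_; Bijection)

-- A finite simple bipartite graph G = (V₁ ∪ V₂, E) with V₁ = Fin m, V₂ = Fin n
-- (disjoint parts, both stable), given by its biadjacency relation:
-- E u v = true  iff  u ∈ V₁ and v ∈ V₂ are adjacent.
BipGraph : ℕ → ℕ → Set
BipGraph m n = Fin m → Fin n → Bool

deg₁ : ∀ {m n} → BipGraph m n → Fin m → ℕ
deg₁ {m} {n} E u = countᵇ (λ v → E u v) (allFin n)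

deg₂ : ∀ {m n} → BipGraph m n → Fin n → ℕ
deg₂ {m} {n} E v = countᵇ (λ u → E u v) (allFin m)

DegSet₁ : ∀ {m n} → BipGraph m n → List ℕ → Set
DegSet₁ E Ps = (∀ u → deg₁ E u ∈ Ps) × (∀ p → p ∈ Ps → ∃ λ u → deg₁ E u ≡ p)

DegSet₂ : ∀ {m n} → BipGraph m n → List ℕ → Set
DegSet₂ E Qs = (∀ v → deg₂ E v ∈ Qs) × (∀ q → q ∈ Qs → ∃ λ v → deg₂ E v ≡ q)

Realizes : ∀ {m n} → BipGraph m n → List ℕ → List ℕ → Set
Realizes E Ps Qs = DegSet₁ E Ps × DegSet₂ E Qs

Bigraphic : List ℕ → List ℕ → Set
Bigraphic Ps Qs = Σ ℕ λ m → Σ ℕ λ n → Σ (BipGraph m n) λ E → Realizes E Ps Qs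

-- mirror bipartite graph: a bijection φ : V₁ → V₂ with
-- u φ(v) ∈ E  iff  φ(u) v ∈ E  (i.e. E u (φ v) ≡ E v (φ u), edges being Booleans)
Mirror : ∀ {m n} → BipGraph m n → Set
Mirror {m} {n} E = Σ (Fin m ⤖ Fin n) λ φ →
  ∀ u v → E u (Bijection.to φ v) ≡ E v (Bijection.to φ u)

module Submission where

open import Defs
open import Data.Nat using (ℕ; _<_; _≤_)
open import Data.List using (List; [])
open import Data.List.Membership.Propositional using (_∈_)
open import Data.List.Relation.Unary.All using (All)
open import Data.Product using (Σ; _×_)
open import Relation.Binary.PropositionalEquality using (_≢_)

open import Data.Nat using (zero; suc; _+_; _∸_; _<ᵇ_; z≤n; z<s; s≤s)
open import Data.Nat.Properties
open import Data.Bool using (Bool; true; false; T)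
open import Data.Fin using (Fin; toℕ; fromℕ<)
import Data.Fin as Fin
open import Data.Fin.Properties using (toℕ<n; toℕ-fromℕ<)
open import Data.Vec using (Vec; []; _∷_; countᵇ; tabulate; allFin)
open import Data.Product using (_,_; ∃)
open import Data.Sum using (inj₁; inj₂)
open import Data.List.Membership.DecPropositional _≟_ using (_∈?_)
import Data.List.Relation.Unary.All as All
open import Function using (_∘′_)
open import Function.Bundles using (_⇔_; mk⇔; Equivalence)
open import Function.Construct.Identity using (⤖-id)
open import Relation.Nullary using (yes; no; contradiction)
open import Relation.Binary.PropositionalEquality
  using (_≡_; refl; sym; trans; cong; subst; module ≡-Reasoning)

-- Let rank x be the number of elements of P in [1, x] and k = rank p₁.  On
-- V₁ = V₂ = {0, …, p₁ − 1} join u and v iff rank u + rank v < k.  The graph is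
-- symmetric, hence mirror via the identity.  As rank is monotone, the
-- neighbourhood of u is an initial segment {v < d}, where d is the least number
-- with rank d = k − rank u, i.e. the (k − rank u)-th element of P; as u ranges
-- over [0, p₁) the value rank u takes every value in [0, k), so every element
-- of P occurs as a degree.

countᵇ-tabulate-prefix : ∀ {A : Set} n (f : Fin n → A) (P : A → Bool) d → d ≤ n →
  (∀ j → T (P (f j)) ⇔ toℕ j < d) → countᵇ P (tabulate f) ≡ d
countᵇ-tabulate-prefix zero f P zero z≤n P⇔ = refl
countᵇ-tabulate-prefix (suc n) f P d d≤ P⇔ with P (f Fin.zero) in eq | d
... | true | zero = contradiction (Equivalence.to (P⇔ Fin.zero) (subst T (sym eq) _)) n≮0
... | true | suc d = cong suc (countᵇ-tabulate-prefix n (λ j → f (Fin.suc j)) P d (≤-pred d≤)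
                        (λ j → mk⇔ (≤-pred ∘′ Equivalence.to (P⇔ (Fin.suc j)))
                                   (Equivalence.from (P⇔ (Fin.suc j)) ∘′ s≤s)))
... | false | suc d = contradiction (Equivalence.from (P⇔ Fin.zero) z<s) (subst T eq)
... | false | zero = countᵇ-tabulate-prefix n (λ j → f (Fin.suc j)) P zero z≤n
                        (λ j → mk⇔ (λ t → contradiction (Equivalence.to (P⇔ (Fin.suc j)) t) n≮0)
                                   (λ ()))

countᵇ-cong : ∀ {A : Set} {n} {P Q : A → Bool} → (∀ x → P x ≡ Q x) →
  (xs : Vec A n) → countᵇ P xs ≡ countᵇ Q xs
countᵇ-cong P≡Q [] = refl
countᵇ-cong {P = P} {Q} P≡Q (x ∷ xs) rewrite P≡Q x with Q x
... | true = cong suc (countᵇ-cong P≡Q xs)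
... | false = countᵇ-cong P≡Q xs

+-<⇔<-∸ : ∀ {m n o} → m ≤ o → (m + n < o ⇔ n < o ∸ m)
+-<⇔<-∸ {m} {n} {o} m≤o = mk⇔
  (λ m+n<o → +-cancelˡ-< m n (o ∸ m) (subst (m + n <_) (sym (m+[n∸m]≡n m≤o)) m+n<o))
  (λ n<o∸m → subst (m + n <_) (m+[n∸m]≡n m≤o) (+-monoʳ-< m n<o∸m))

IsSymmetric : ∀ {n} → BipGraph n n → Set
IsSymmetric E = ∀ u v → E u v ≡ E v u

module _ {n} {E : BipGraph n n} (E-sym : IsSymmetric E) where

  symmetric⇒deg₂≡deg₁ : ∀ v → deg₂ E v ≡ deg₁ E v
  symmetric⇒deg₂≡deg₁ v = countᵇ-cong (λ u → E-sym u v) (allFin n)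

  symmetric⇒realizes : ∀ {Ps} → DegSet₁ E Ps → Realizes E Ps Ps
  symmetric⇒realizes (degs∈ , onto) =
    (degs∈ , onto) ,
    (λ v → subst (_∈ _) (sym (symmetric⇒deg₂≡deg₁ v)) (degs∈ v)) ,
    (λ p p∈ → let u , deg≡p = onto p p∈ in u , trans (symmetric⇒deg₂≡deg₁ u) deg≡p)

  symmetric⇒mirror : Mirror E
  symmetric⇒mirror = ⤖-id (Fin n) , E-sym

module Rank (Ps : List ℕ) where

  rank : ℕ → ℕ
  rank zero = zero
  rank (suc x) with suc x ∈? Ps
  ... | yes _ = suc (rank x)
  ... | no _ = rank x

  rank-≤-suc : ∀ x → rank x ≤ rank (suc x)
  rank-≤-suc x with suc x ∈? Ps
  ... | yes _ = n≤1+n (rank x)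
  ... | no _ = ≤-refl

  rank-suc-≤ : ∀ x → rank (suc x) ≤ suc (rank x)
  rank-suc-≤ x with suc x ∈? Ps
  ... | yes _ = ≤-refl
  ... | no _ = n≤1+n (rank x)

  rank-suc-∈ : ∀ {x} → suc x ∈ Ps → rank (suc x) ≡ suc (rank x)
  rank-suc-∈ {x} sx∈ with suc x ∈? Ps
  ... | yes _ = refl
  ... | no sx∉ = contradiction sx∈ sx∉

  rank-jump⇒∈ : ∀ {x} → rank x < rank (suc x) → suc x ∈ Ps
  rank-jump⇒∈ {x} jump with suc x ∈? Ps
  ... | yes sx∈ = sx∈
  ... | no _ = contradiction jump (<-irrefl refl)

  rank-mono : ∀ {x y} → x ≤ y → rank x ≤ rank y
  rank-mono {y = zero} z≤n = ≤-refl
  rank-mono {x} {suc y} x≤sy with m≤n⇒m<n∨m≡n x≤sy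
  ... | inj₁ x<sy = ≤-trans (rank-mono (≤-pred x<sy)) (rank-≤-suc y)
  ... | inj₂ refl = ≤-refl

  rank-<⇔< : ∀ {p} → p ∈ Ps → ∀ j → rank j < rank p ⇔ j < p
  rank-<⇔< {p} p∈ j = mk⇔
    (λ rj<rp → ≰⇒> (λ p≤j → <⇒≱ rj<rp (rank-mono p≤j)))
    (rank-strict-below p∈)
    where
      rank-strict-below : ∀ {q} → q ∈ Ps → j < q → rank j < rank q
      rank-strict-below {suc q} sq∈ (s≤s j≤q) =
        subst (rank j <_) (sym (rank-suc-∈ sq∈)) (s≤s (rank-mono j≤q))

  rank-threshold : ∀ m c → 0 < c → c ≤ rank m →
    ∃ λ d → d ∈ Ps × d ≤ m × (∀ j → rank j < c ⇔ j < d)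
  rank-threshold zero c 0<c c≤0 = contradiction (<-≤-trans 0<c c≤0) (<-irrefl refl)
  rank-threshold (suc m) c 0<c c≤ with c ≤? rank m
  ... | yes c≤rm = let d , d∈ , d≤m , cut = rank-threshold m c 0<c c≤rm in
                   d , d∈ , m≤n⇒m≤1+n d≤m , cut
  ... | no c≰rm = suc m , sm∈ , ≤-refl ,
                  subst (λ c → ∀ j → rank j < c ⇔ j < suc m) (sym c≡) (rank-<⇔< sm∈)
    where
      rm<c : rank m < c
      rm<c = ≰⇒> c≰rm
      sm∈ : suc m ∈ Ps
      sm∈ = rank-jump⇒∈ (<-≤-trans rm<c c≤)
      c≡ : c ≡ rank (suc m)
      c≡ = ≤-antisym c≤ (≤-trans (rank-suc-≤ m) rm<c)

  rank-intermediate : ∀ m t → t < rank m → ∃ λ a → a < m × rank a ≡ t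
  rank-intermediate zero t ()
  rank-intermediate (suc m) t t< with t <? rank m
  ... | yes t<rm = let a , a<m , ra≡t = rank-intermediate m t t<rm in a , m<n⇒m<1+n a<m , ra≡t
  ... | no t≮rm = m , ≤-refl , ≤-antisym (≮⇒≥ t≮rm) (≤-pred (<-≤-trans t< (rank-suc-≤ m)))

  rankGraph : ∀ n → BipGraph n n
  rankGraph n u v = rank (toℕ u) + rank (toℕ v) <ᵇ rank n

  rankGraph-symmetric : ∀ n → IsSymmetric (rankGraph n)
  rankGraph-symmetric n u v = cong (_<ᵇ rank n) (+-comm (rank (toℕ u)) (rank (toℕ v)))

  deg-rankGraph : ∀ {n} (u : Fin n) d → d ≤ n →
    (∀ j → rank j < rank n ∸ rank (toℕ u) ⇔ j < d) → deg₁ (rankGraph n) u ≡ d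
  deg-rankGraph {n} u d d≤n cut =
    countᵇ-tabulate-prefix n (λ v → v) (rankGraph n u) d d≤n (λ v → mk⇔
      (Equivalence.to (cut (toℕ v)) ∘′ Equivalence.to edge⇔ ∘′ <ᵇ⇒< _ _)
      (<⇒<ᵇ ∘′ Equivalence.from edge⇔ ∘′ Equivalence.from (cut (toℕ v))))
    where
      edge⇔ : ∀ {j} → rank (toℕ u) + j < rank n ⇔ j < rank n ∸ rank (toℕ u)
      edge⇔ = +-<⇔<-∸ (rank-mono (<⇒≤ (toℕ<n u)))

  deg-rankGraph-∸-rank : ∀ {n p} → p ∈ Ps → p ≤ n → (u : Fin n) →
    rank n ∸ rank (toℕ u) ≡ rank p → deg₁ (rankGraph n) u ≡ p
  deg-rankGraph-∸-rank {p = p} p∈ p≤n u complement = deg-rankGraph u p p≤n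
    (λ j → subst (λ c → rank j < c ⇔ j < p) (sym complement) (rank-<⇔< p∈ j))

  deg-rankGraph-∈ : ∀ {p₁} → p₁ ∈ Ps → ∀ u → deg₁ (rankGraph p₁) u ∈ Ps
  deg-rankGraph-∈ {p₁} p₁∈ u =
    let d , d∈ , d≤p₁ , cut = rank-threshold p₁ (rank p₁ ∸ rank (toℕ u))
                                (m<n⇒0<n∸m ru<rp₁) (m∸n≤m (rank p₁) (rank (toℕ u)))
    in subst (_∈ Ps) (sym (deg-rankGraph u d d≤p₁ cut)) d∈
    where
      ru<rp₁ : rank (toℕ u) < rank p₁
      ru<rp₁ = Equivalence.from (rank-<⇔< p₁∈ (toℕ u)) (toℕ<n u)

  deg-rankGraph-onto : ∀ {p₁} → All (λ p → 0 < p) Ps → All (λ p → p ≤ p₁) Ps →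
    ∀ p → p ∈ Ps → ∃ λ u → deg₁ (rankGraph p₁) u ≡ p
  deg-rankGraph-onto {p₁} pos bounded p p∈ =
    let a , a<p₁ , ra≡ = rank-intermediate p₁ (rank p₁ ∸ rank p) (∸-monoʳ-< 0<rp rp≤rp₁)
    in fromℕ< a<p₁ ,
       deg-rankGraph-∸-rank p∈ (All.lookup bounded p∈) (fromℕ< a<p₁) (complement a<p₁ ra≡)
    where
      rp≤rp₁ : rank p ≤ rank p₁
      rp≤rp₁ = rank-mono (All.lookup bounded p∈)
      0<rp : 0 < rank p
      0<rp = Equivalence.from (rank-<⇔< p∈ 0) (All.lookup pos p∈)
      complement : ∀ {a} (a<p₁ : a < p₁) → rank a ≡ rank p₁ ∸ rank p →
        rank p₁ ∸ rank (toℕ (fromℕ< a<p₁)) ≡ rank p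
      complement {a} a<p₁ ra≡ = begin
        rank p₁ ∸ rank (toℕ (fromℕ< a<p₁)) ≡⟨ cong (λ x → rank p₁ ∸ rank x) (toℕ-fromℕ< a<p₁) ⟩
        rank p₁ ∸ rank a                   ≡⟨ cong (rank p₁ ∸_) ra≡ ⟩
        rank p₁ ∸ (rank p₁ ∸ rank p)       ≡⟨ m∸[m∸n]≡n rp≤rp₁ ⟩
        rank p                             ∎
        where open ≡-Reasoning

mainTheorem7 : (Ps : List ℕ) → Ps ≢ [] → All (λ p → 0 < p) Ps →
    (p₁ : ℕ) → p₁ ∈ Ps → All (λ p → p ≤ p₁) Ps →
    Bigraphic Ps Ps ×
    Σ (BipGraph p₁ p₁) (λ E → Realizes E Ps Ps × Mirror E)
mainTheorem7 Ps _ pos p₁ p₁∈ bounded =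
  (p₁ , p₁ , rankGraph p₁ , realizes) , (rankGraph p₁ , realizes , symmetric⇒mirror G-sym)
  where
    open Rank Ps
    G-sym : IsSymmetric (rankGraph p₁)
    G-sym = rankGraph-symmetric p₁
    realizes : Realizes (rankGraph p₁) Ps Ps
    realizes = symmetric⇒realizes G-sym
      (deg-rankGraph-∈ p₁∈ , deg-rankGraph-onto pos bounded)
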